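{- Let $\mathsf{Ax}\subseteq\{N_\Diamond, C_\Diamond, I_{\Diamond\Box}\}$. Then $\mathsf{CK}\oplus\mathsf{Ax}$ is a conservative extension of $\mathsf{CK}_\Box$ if and only if $N_\Diamond\notin\mathsf{Ax}$ or $I_{\Diamond\Box}\notin\mathsf{Ax}$.
   Context: Formulas are built from a countably infinite set of propositional variables $p,q,\dots$ by $\varphi ::= p \mid \bot \mid \varphi\wedge\varphi \mid \varphi\vee\varphi \mid \varphi\to\varphi \mid \Box\varphi \mid \Diamond\varphi$; $\neg\varphi:=\varphi\to\bot$. For a set $\mathsf{Ax}$ of formulas, $\mathsf{CK}\oplus\mathsf{Ax}$ is the consequence relation $\Gamma\vdash_{\mathsf{Ax}}\varphi$ generated by: (Ax) $\Gamma\vdash\varphi$ whenever $\varphi$ is a substitution instance of an axiom of a standard Hilbert axiomatisation of intuitionistic propositional logic, of $\Box(p\to q)\to(\Box p\to\Box q)$, of $\Box(p\to q)\to(\Diamond p\to\Diamond q)$, or of a formula in $\mathsf{Ax}$; (El) $\Gamma\vdash\varphi$ if $\varphi\in\Gamma$; (MP) from $\Gamma\vdash\varphi$ and $\Gamma\vdash\varphi\to\psi$ infer $\Gamma\vdash\psi$; (Nec) from $\emptyset\vdash\varphi$ infer $\Gamma\vdash\Box\varphi$. Axioms: $N_\Diamond$: $\Diamond\bot\to\bot$; $C_\Diamond$: $\Diamond(p\vee q)\to\Diamond p\vee\Diamond q$; $I_{\Diamond\Box}$: $(\Diamond p\to\Box q)\to\Box(p\to q)$. $\mathsf{CK}_\Box$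 is the logic over $\Diamond$-free formulas axiomatised by intuitionistic propositional logic, the axiom $\Box(p\to q)\to(\Box p\to\Box q)$, modus ponens and necessitation (from $\varphi$ infer $\Box\varphi$). A logic is a conservative extension of $\mathsf{CK}_\Box$ if its $\Diamond$-free fragment coincides with $\mathsf{CK}_\Box$, i.e. a $\Diamond$-free formula is derivable in it iff it is derivable in $\mathsf{CK}_\Box$. -}

module Defs where

open import Data.Nat using (ℕ)
open import Data.Bool using (Bool; true; false)
open import Data.Empty using (⊥)
open import Data.Unit using (⊤)
open import Data.Product using (Σ; _×_; _,_)
open import Data.Sum using (_⊎_)
open import Relation.Binary.PropositionalEquality using (_≡_)
open import Function.Bundles using (_⇔_)

infixr 6 _∧'_
infixr 5 _∨'_
infixr 4 _⇒_

data Fm : Set where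
  var  : ℕ → Fm
  ⊥'   : Fm
  _∧'_ : Fm → Fm → Fm
  _∨'_ : Fm → Fm → Fm
  _⇒_  : Fm → Fm → Fm
  □    : Fm → Fm
  ◇    : Fm → Fm

¬' : Fm → Fm
¬' φ = φ ⇒ ⊥'

sub : (ℕ → Fm) → Fm → Fm
sub σ (var n)  = σ n
sub σ ⊥'       = ⊥'
sub σ (φ ∧' ψ) = sub σ φ ∧' sub σ ψ
sub σ (φ ∨' ψ) = sub σ φ ∨' sub σ ψ
sub σ (φ ⇒ ψ)  = sub σ φ ⇒ sub σ ψ
sub σ (□ φ)    = □ (sub σ φ)
sub σ (◇ φ)    = ◇ (sub σ φ)

Instance : Fm → Fm → Set
Instance A φ = Σ (ℕ → Fm) λ σ → φ ≡ sub σ A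

DiamondFree : Fm → Set
DiamondFree (var _)  = ⊤
DiamondFree ⊥'       = ⊤
DiamondFree (φ ∧' ψ) = DiamondFree φ × DiamondFree ψ
DiamondFree (φ ∨' ψ) = DiamondFree φ × DiamondFree ψ
DiamondFree (φ ⇒ ψ)  = DiamondFree φ × DiamondFree ψ
DiamondFree (□ φ)    = DiamondFree φ
DiamondFree (◇ φ)    = ⊥

p q r : Fm
p = var 0
q = var 1
r = var 2

data IPCAxiom : Fm → Set where
  ax-K    : IPCAxiom (p ⇒ q ⇒ p)
  ax-S    : IPCAxiom ((p ⇒ q ⇒ r) ⇒ (p ⇒ q) ⇒ p ⇒ r)
  ax-∧E₁  : IPCAxiom (p ∧' q ⇒ p)
  ax-∧E₂  : IPCAxiom (p ∧' q ⇒ q)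
  ax-∧I   : IPCAxiom (p ⇒ q ⇒ p ∧' q)
  ax-∨I₁  : IPCAxiom (p ⇒ p ∨' q)
  ax-∨I₂  : IPCAxiom (q ⇒ p ∨' q)
  ax-∨E   : IPCAxiom ((p ⇒ r) ⇒ (q ⇒ r) ⇒ p ∨' q ⇒ r)
  ax-⊥E   : IPCAxiom (⊥' ⇒ p)

K□ K◇ : Fm
K□ = □ (p ⇒ q) ⇒ □ p ⇒ □ q
K◇ = □ (p ⇒ q) ⇒ ◇ p ⇒ ◇ q

data CKAxiom : Fm → Set where
  ipc : ∀ {A} → IPCAxiom A → CKAxiom A
  k□  : CKAxiom K□
  k◇  : CKAxiom K◇

data Extra : Set where
  N◇ C◇ I◇□ : Extra

extraFm : Extra → Fm
extraFm N◇  = ◇ ⊥' ⇒ ⊥'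
extraFm C◇  = ◇ (p ∨' q) ⇒ ◇ p ∨' ◇ q
extraFm I◇□ = (◇ p ⇒ □ q) ⇒ □ (p ⇒ q)

AxSet : Set
AxSet = Extra → Bool

_∈Ax_ : Extra → AxSet → Set
e ∈Ax Ax = Ax e ≡ true

FmSet : Set₁
FmSet = Fm → Set

∅ : FmSet
∅ _ = ⊥

data _⊢[_]_ : FmSet → AxSet → Fm → Set₁ where
  axCK : ∀ {Γ Ax A φ} → CKAxiom A → Instance A φ → Γ ⊢[ Ax ] φ
  axEx : ∀ {Γ Ax e φ} → e ∈Ax Ax → Instance (extraFm e) φ → Γ ⊢[ Ax ] φ
  el   : ∀ {Γ Ax φ} → Γ φ → Γ ⊢[ Ax ] φ
  mp   : ∀ {Γ Ax φ ψ} → Γ ⊢[ Ax ] φ → Γ ⊢[ Ax ] (φ ⇒ ψ) → Γ ⊢[ Ax ] ψ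
  nec  : ∀ {Γ Ax φ} → ∅ ⊢[ Ax ] φ → Γ ⊢[ Ax ] □ φ

data CK□⊢_ : Fm → Set where
  ax  : ∀ {A φ} → IPCAxiom A → Instance A φ → DiamondFree φ → CK□⊢ φ
  k   : ∀ {φ} → Instance K□ φ → DiamondFree φ → CK□⊢ φ
  mp  : ∀ {φ ψ} → CK□⊢ φ → CK□⊢ (φ ⇒ ψ) → CK□⊢ ψ
  nec : ∀ {φ} → CK□⊢ φ → CK□⊢ □ φ

ConservativeOverCK□ : AxSet → Set₁
ConservativeOverCK□ Ax =
  ∀ φ → DiamondFree φ → ((∅ ⊢[ Ax ] φ → CK□⊢ φ) × (CK□⊢ φ → ∅ ⊢[ Ax ] φ))

{-# OPTIONS --safe #-}
module Submission where

-- If N◇ ∉ Ax, replace every ◇φ by ⊤; if I◇□ ∉ Ax, by ⊥. Either erasure fixes ◇-free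
-- formulas and sends every axiom of CK ⊕ Ax to a theorem of CK□, so it maps ◇-free
-- theorems of CK ⊕ Ax to theorems of CK□.
-- With both N◇ and I◇□, ◇⊤ ∧ □⊥ ⊢ ◇⊥ ⊢ ⊥, so ¬¬□⊥ ⊢ ◇⊤ → □⊥, which I◇□ turns into
-- □(⊤ → ⊥), that is □⊥. But ¬¬□⊥ → □⊥ fails in the model of CK□ given by the Heyting
-- chain 0 < ½ < 1 with □x = ½ ∨ x.

open import Defs
open import Data.Bool using (true; false; if_then_else_)
open import Data.Empty using (⊥-elim)
open import Data.Fin using (Fin; zero; suc)
open import Data.Fin.Properties using (all?; _≟_; _≤?_)
open import Data.Nat using (ℕ; zero; suc)
open import Data.Product using (_×_; _,_; proj₁)
open import Data.Sum using (_⊎_; inj₁; inj₂)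
open import Data.Unit using (tt)
open import Relation.Binary.PropositionalEquality using (_≡_; refl; sym; trans; cong; cong₂; subst)
open import Relation.Nullary using (¬_)
open import Relation.Nullary.Decidable using (True; toWitness; ⌊_⌋)

private
  variable
    Γ : FmSet
    Ax : AxSet
    A φ ψ χ c : Fm
    σ : ℕ → Fm

[_,_,_] : {X : Set} → X → X → X → ℕ → X
[ x , y , z ] zero          = x
[ x , y , z ] (suc zero)    = y
[ x , y , z ] (suc (suc _)) = z

⊤' : Fm
⊤' = ¬' ⊥'

DiamondFreeSub : (ℕ → Fm) → Set
DiamondFreeSub σ = ∀ n → DiamondFree (σ n)

sub-DiamondFree : DiamondFreeSub σ → ∀ A → DiamondFree A → DiamondFree (sub σ A)
sub-DiamondFree σ-DF (var n)  _         = σ-DF n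
sub-DiamondFree σ-DF ⊥'       _         = tt
sub-DiamondFree σ-DF (A ∧' B) (dA , dB) = sub-DiamondFree σ-DF A dA , sub-DiamondFree σ-DF B dB
sub-DiamondFree σ-DF (A ∨' B) (dA , dB) = sub-DiamondFree σ-DF A dA , sub-DiamondFree σ-DF B dB
sub-DiamondFree σ-DF (A ⇒ B)  (dA , dB) = sub-DiamondFree σ-DF A dA , sub-DiamondFree σ-DF B dB
sub-DiamondFree σ-DF (□ A)    dA        = sub-DiamondFree σ-DF A dA

[,,]-DiamondFree : DiamondFree φ → DiamondFree ψ → DiamondFree χ → DiamondFreeSub [ φ , ψ , χ ]
[,,]-DiamondFree dφ dψ dχ zero          = dφ
[,,]-DiamondFree dφ dψ dχ (suc zero)    = dψ
[,,]-DiamondFree dφ dψ dχ (suc (suc _)) = dχ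

IPCAxiom-DiamondFree : IPCAxiom A → DiamondFree A
IPCAxiom-DiamondFree ax-K   = _
IPCAxiom-DiamondFree ax-S   = _
IPCAxiom-DiamondFree ax-∧E₁ = _
IPCAxiom-DiamondFree ax-∧E₂ = _
IPCAxiom-DiamondFree ax-∧I  = _
IPCAxiom-DiamondFree ax-∨I₁ = _
IPCAxiom-DiamondFree ax-∨I₂ = _
IPCAxiom-DiamondFree ax-∨E  = _
IPCAxiom-DiamondFree ax-⊥E  = _


infix 25 _[◇≔_]

_[◇≔_] : Fm → Fm → Fm
var n    [◇≔ c ] = var n
⊥'       [◇≔ c ] = ⊥'
(φ ∧' ψ) [◇≔ c ] = φ [◇≔ c ] ∧' ψ [◇≔ c ]
(φ ∨' ψ) [◇≔ c ] = φ [◇≔ c ] ∨' ψ [◇≔ c ]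
(φ ⇒ ψ)  [◇≔ c ] = φ [◇≔ c ] ⇒ ψ [◇≔ c ]
□ φ      [◇≔ c ] = □ (φ [◇≔ c ])
◇ φ      [◇≔ c ] = c

[◇≔]-DiamondFree : DiamondFree c → ∀ φ → DiamondFree (φ [◇≔ c ])
[◇≔]-DiamondFree dc (var n)  = tt
[◇≔]-DiamondFree dc ⊥'       = tt
[◇≔]-DiamondFree dc (φ ∧' ψ) = [◇≔]-DiamondFree dc φ , [◇≔]-DiamondFree dc ψ
[◇≔]-DiamondFree dc (φ ∨' ψ) = [◇≔]-DiamondFree dc φ , [◇≔]-DiamondFree dc ψ
[◇≔]-DiamondFree dc (φ ⇒ ψ)  = [◇≔]-DiamondFree dc φ , [◇≔]-DiamondFree dc ψ
[◇≔]-DiamondFree dc (□ φ)    = [◇≔]-DiamondFree dc φ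
[◇≔]-DiamondFree dc (◇ φ)    = dc

[◇≔]-identity : ∀ φ → DiamondFree φ → φ [◇≔ c ] ≡ φ
[◇≔]-identity (var n)  _         = refl
[◇≔]-identity ⊥'       _         = refl
[◇≔]-identity (φ ∧' ψ) (dφ , dψ) = cong₂ _∧'_ ([◇≔]-identity φ dφ) ([◇≔]-identity ψ dψ)
[◇≔]-identity (φ ∨' ψ) (dφ , dψ) = cong₂ _∨'_ ([◇≔]-identity φ dφ) ([◇≔]-identity ψ dψ)
[◇≔]-identity (φ ⇒ ψ)  (dφ , dψ) = cong₂ _⇒_ ([◇≔]-identity φ dφ) ([◇≔]-identity ψ dψ)
[◇≔]-identity (□ φ)    dφ        = cong □ ([◇≔]-identity φ dφ)

[◇≔]-sub : ∀ σ A → DiamondFree A → sub σ A [◇≔ c ] ≡ sub (λ n → σ n [◇≔ c ]) A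
[◇≔]-sub σ (var n)  _         = refl
[◇≔]-sub σ ⊥'       _         = refl
[◇≔]-sub σ (A ∧' B) (dA , dB) = cong₂ _∧'_ ([◇≔]-sub σ A dA) ([◇≔]-sub σ B dB)
[◇≔]-sub σ (A ∨' B) (dA , dB) = cong₂ _∨'_ ([◇≔]-sub σ A dA) ([◇≔]-sub σ B dB)
[◇≔]-sub σ (A ⇒ B)  (dA , dB) = cong₂ _⇒_ ([◇≔]-sub σ A dA) ([◇≔]-sub σ B dB)
[◇≔]-sub σ (□ A)    dA        = cong □ ([◇≔]-sub σ A dA)


CK□-axiom : IPCAxiom A → ∀ σ → DiamondFreeSub σ → CK□⊢ sub σ A
CK□-axiom {A} i σ σ-DF = ax i (σ , refl) (sub-DiamondFree σ-DF A (IPCAxiom-DiamondFree i))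

CK□-K□ : ∀ σ → DiamondFreeSub σ → CK□⊢ sub σ K□
CK□-K□ σ σ-DF = k (σ , refl) (sub-DiamondFree {σ} σ-DF K□ _)

CK□-id : DiamondFree φ → CK□⊢ (φ ⇒ φ)
CK□-id {φ} dφ =
  mp (CK□-axiom ax-K [ φ , φ , φ ] ([,,]-DiamondFree dφ dφ dφ))
     (mp (CK□-axiom ax-K [ φ , φ ⇒ φ , φ ] ([,,]-DiamondFree dφ (dφ , dφ) dφ))
         (CK□-axiom ax-S [ φ , φ ⇒ φ , φ ] ([,,]-DiamondFree dφ (dφ , dφ) dφ)))

CK□-weaken : DiamondFree φ → DiamondFree ψ → CK□⊢ ψ → CK□⊢ (φ ⇒ ψ)
CK□-weaken {φ} {ψ} dφ dψ d = mp d (CK□-axiom ax-K [ ψ , φ , ψ ] ([,,]-DiamondFree dψ dφ dψ))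

CK□⊆CK⊕ : CK□⊢ φ → Γ ⊢[ Ax ] φ
CK□⊆CK⊕ (ax i s _) = axCK (ipc i) s
CK□⊆CK⊕ (k s _)    = axCK k□ s
CK□⊆CK⊕ (mp d e)   = mp (CK□⊆CK⊕ d) (CK□⊆CK⊕ e)
CK□⊆CK⊕ (nec d)    = nec (CK□⊆CK⊕ d)


ErasureValid : Fm → AxSet → Set
ErasureValid c Ax = ∀ e → e ∈Ax Ax → ∀ σ → CK□⊢ sub σ (extraFm e) [◇≔ c ]

erase-derivation : DiamondFree c → ErasureValid c Ax → ∅ ⊢[ Ax ] φ → CK□⊢ φ [◇≔ c ]
erase-derivation {c} {Ax} dc valid = erase
  where
  erasedSub : (ℕ → Fm) → ℕ → Fm
  erasedSub σ n = σ n [◇≔ c ]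

  erased-DiamondFree : ∀ σ → DiamondFreeSub (erasedSub σ)
  erased-DiamondFree σ n = [◇≔]-DiamondFree dc (σ n)

  erase : ∅ ⊢[ Ax ] φ → CK□⊢ φ [◇≔ c ]
  erase (axCK {A = A} (ipc i) (σ , refl)) =
    subst CK□⊢_ (sym ([◇≔]-sub σ A (IPCAxiom-DiamondFree i)))
      (CK□-axiom i (erasedSub σ) (erased-DiamondFree σ))
  erase (axCK k□ (σ , refl)) = CK□-K□ (erasedSub σ) (erased-DiamondFree σ)
  erase (axCK k◇ (σ , refl)) =
    CK□-weaken (erased-DiamondFree σ 0 , erased-DiamondFree σ 1) (dc , dc) (CK□-id dc)
  erase (axEx e∈Ax (σ , refl)) = valid _ e∈Ax σ
  erase (mp d e) = mp (erase d) (erase e)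
  erase (nec d)  = nec (erase d)

conservative-by-erasure : DiamondFree c → ErasureValid c Ax → ConservativeOverCK□ Ax
conservative-by-erasure dc valid φ dφ =
  (λ d → subst CK□⊢_ ([◇≔]-identity φ dφ) (erase-derivation dc valid d)) , CK□⊆CK⊕

noExtras : AxSet
noExtras _ = false

CK-conservative : ConservativeOverCK□ noExtras
CK-conservative = conservative-by-erasure {c = ⊥'} tt (λ _ ())

C◇-erasure-valid : DiamondFree c → ∀ σ → CK□⊢ sub σ (extraFm C◇) [◇≔ c ]
C◇-erasure-valid {c} dc σ = CK□-axiom ax-∨I₁ (λ _ → c) (λ _ → dc)


⊢ipc : IPCAxiom A → ∀ σ → Γ ⊢[ Ax ] sub σ A
⊢ipc i σ = axCK (ipc i) (σ , refl)

⊢K : Γ ⊢[ Ax ] (φ ⇒ ψ ⇒ φ)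
⊢K {φ = φ} {ψ = ψ} = ⊢ipc ax-K [ φ , ψ , φ ]

⊢S : Γ ⊢[ Ax ] ((φ ⇒ ψ ⇒ χ) ⇒ (φ ⇒ ψ) ⇒ φ ⇒ χ)
⊢S {φ = φ} {ψ = ψ} {χ = χ} = ⊢ipc ax-S [ φ , ψ , χ ]

⊢I : Γ ⊢[ Ax ] (φ ⇒ φ)
⊢I {φ = φ} = mp (⊢K {ψ = φ}) (mp (⊢K {ψ = φ ⇒ φ}) ⊢S)

⊢⊥E : Γ ⊢[ Ax ] (⊥' ⇒ φ)
⊢⊥E {φ = φ} = ⊢ipc ax-⊥E (λ _ → φ)

⊢K□ : Γ ⊢[ Ax ] (□ (φ ⇒ ψ) ⇒ □ φ ⇒ □ ψ)
⊢K□ {φ = φ} {ψ = ψ} = axCK k□ ([ φ , ψ , φ ] , refl)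

⊢K◇ : Γ ⊢[ Ax ] (□ (φ ⇒ ψ) ⇒ ◇ φ ⇒ ◇ ψ)
⊢K◇ {φ = φ} {ψ = ψ} = axCK k◇ ([ φ , ψ , φ ] , refl)

□-mono : ∅ ⊢[ Ax ] (φ ⇒ ψ) → Γ ⊢[ Ax ] (□ φ ⇒ □ ψ)
□-mono d = mp (nec d) ⊢K□

_,,_ : FmSet → Fm → FmSet
(Γ ,, φ) ψ = Γ ψ ⊎ ψ ≡ φ

hyp : (Γ ,, φ) ⊢[ Ax ] φ
hyp = el (inj₂ refl)

weaken : Γ ⊢[ Ax ] ψ → (Γ ,, φ) ⊢[ Ax ] ψ
weaken (axCK a s) = axCK a s
weaken (axEx e s) = axEx e s
weaken (el γ)     = el (inj₁ γ)
weaken (mp d e)   = mp (weaken d) (weaken e)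
weaken (nec d)    = nec d

deduction : (Γ ,, φ) ⊢[ Ax ] ψ → Γ ⊢[ Ax ] (φ ⇒ ψ)
deduction (axCK a s)       = mp (axCK a s) ⊢K
deduction (axEx e s)       = mp (axEx e s) ⊢K
deduction (el (inj₁ γ))    = mp (el γ) ⊢K
deduction (el (inj₂ refl)) = ⊢I
deduction (mp d e)         = mp (deduction d) (mp (deduction e) ⊢S)
deduction (nec d)          = mp (nec d) ⊢K


⊢I◇□[◇≔⊤] : Γ ⊢[ Ax ] ((⊤' ⇒ □ ψ) ⇒ □ (φ ⇒ ψ))
⊢I◇□[◇≔⊤] = deduction (mp (mp ⊢I hyp) (□-mono ⊢K))

erasure-⊤-valid : ¬ (N◇ ∈Ax Ax) → ErasureValid ⊤' Ax
erasure-⊤-valid N∉ N◇  N∈ σ = ⊥-elim (N∉ N∈)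
erasure-⊤-valid N∉ C◇  _  σ = C◇-erasure-valid (tt , tt) σ
erasure-⊤-valid N∉ I◇□ _  σ = proj₁ (CK-conservative _ ((_ , dψ) , dφ , dψ)) ⊢I◇□[◇≔⊤]
  where
  dφ : DiamondFree (σ 0 [◇≔ ⊤' ])
  dφ = [◇≔]-DiamondFree (tt , tt) (σ 0)
  dψ : DiamondFree (σ 1 [◇≔ ⊤' ])
  dψ = [◇≔]-DiamondFree (tt , tt) (σ 1)

erasure-⊥-valid : ¬ (I◇□ ∈Ax Ax) → ErasureValid ⊥' Ax
erasure-⊥-valid I∉ N◇  _  σ = CK□-axiom ax-⊥E (λ _ → ⊥') (λ _ → tt)
erasure-⊥-valid I∉ C◇  _  σ = C◇-erasure-valid tt σ
erasure-⊥-valid I∉ I◇□ I∈ σ = ⊥-elim (I∉ I∈)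


¬¬□⊥⇒□⊥ : Fm
¬¬□⊥⇒□⊥ = ¬' (¬' (□ ⊥')) ⇒ □ ⊥'

◇⊤,□⊥⊢⊥ : N◇ ∈Ax Ax → ((Γ ,, ◇ ⊤') ,, □ ⊥') ⊢[ Ax ] ⊥'
◇⊤,□⊥⊢⊥ N∈ = mp (mp (weaken hyp) (mp (mp hyp (□-mono ⊢⊥E)) ⊢K◇)) (axEx N∈ (var , refl))

N◇,I◇□⊢¬¬□⊥⇒□⊥ : N◇ ∈Ax Ax → I◇□ ∈Ax Ax → ∅ ⊢[ Ax ] ¬¬□⊥⇒□⊥
N◇,I◇□⊢¬¬□⊥⇒□⊥ N∈ I∈ = deduction (mp (nec ⊢I) (mp □[⊤⇒⊥] ⊢K□))
  where
  ◇⊤⇒□⊥ : (∅ ,, ¬' (¬' (□ ⊥'))) ⊢[ _ ] (◇ ⊤' ⇒ □ ⊥')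
  ◇⊤⇒□⊥ = deduction (mp (mp (deduction (◇⊤,□⊥⊢⊥ N∈)) (weaken hyp)) ⊢⊥E)

  □[⊤⇒⊥] : (∅ ,, ¬' (¬' (□ ⊥'))) ⊢[ _ ] □ (⊤' ⇒ ⊥')
  □[⊤⇒⊥] = mp ◇⊤⇒□⊥ (axEx I∈ ([ ⊤' , ⊥' , ⊥' ] , refl))


𝟛 : Set
𝟛 = Fin 3

pattern 0₃ = zero
pattern ½  = suc zero
pattern 1₃ = suc (suc zero)

infixr 7 _⊓₃_
infixr 6 _⊔₃_
infixr 5 _⇛_

_⊓₃_ _⊔₃_ _⇛_ : 𝟛 → 𝟛 → 𝟛
x ⊓₃ y = if ⌊ x ≤? y ⌋ then x else y
x ⊔₃ y = if ⌊ x ≤? y ⌋ then y else x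
x ⇛ y  = if ⌊ x ≤? y ⌋ then 1₃ else y

□₃ : 𝟛 → 𝟛
□₃ x = ½ ⊔₃ x

⟦_⟧ : Fm → (ℕ → 𝟛) → 𝟛
⟦ var n ⟧  v = v n
⟦ ⊥' ⟧     v = 0₃
⟦ φ ∧' ψ ⟧ v = ⟦ φ ⟧ v ⊓₃ ⟦ ψ ⟧ v
⟦ φ ∨' ψ ⟧ v = ⟦ φ ⟧ v ⊔₃ ⟦ ψ ⟧ v
⟦ φ ⇒ ψ ⟧  v = ⟦ φ ⟧ v ⇛ ⟦ ψ ⟧ v
⟦ □ φ ⟧    v = □₃ (⟦ φ ⟧ v)
⟦ ◇ φ ⟧    v = 0₃   -- arbitrary: CK□ never mentions ◇

Valid : Fm → Set
Valid φ = ∀ v → ⟦ φ ⟧ v ≡ 1₃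

⟦⟧-sub : ∀ σ A v → ⟦ sub σ A ⟧ v ≡ ⟦ A ⟧ (λ n → ⟦ σ n ⟧ v)
⟦⟧-sub σ (var n)  v = refl
⟦⟧-sub σ ⊥'       v = refl
⟦⟧-sub σ (A ∧' B) v = cong₂ _⊓₃_ (⟦⟧-sub σ A v) (⟦⟧-sub σ B v)
⟦⟧-sub σ (A ∨' B) v = cong₂ _⊔₃_ (⟦⟧-sub σ A v) (⟦⟧-sub σ B v)
⟦⟧-sub σ (A ⇒ B)  v = cong₂ _⇛_ (⟦⟧-sub σ A v) (⟦⟧-sub σ B v)
⟦⟧-sub σ (□ A)    v = cong □₃ (⟦⟧-sub σ A v)
⟦⟧-sub σ (◇ A)    v = refl

valid-instance : ∀ σ A → Valid A → Valid (sub σ A)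
valid-instance σ A valid v = trans (⟦⟧-sub σ A v) (valid _)

valid-by-truth-table : ∀ A → {True (all? λ x → all? λ y → all? λ z → ⟦ A ⟧ [ x , y , z ] ≟ 1₃)} →
                       (v : ℕ → 𝟛) → ⟦ A ⟧ [ v 0 , v 1 , v 2 ] ≡ 1₃
valid-by-truth-table A {table} v = toWitness table (v 0) (v 1) (v 2)

-- Each axiom mentions only p, q and r, so ⟦ A ⟧ [ v 0 , v 1 , v 2 ] computes to ⟦ A ⟧ v.
IPCAxiom-valid : IPCAxiom A → Valid A
IPCAxiom-valid {A} ax-K v   = valid-by-truth-table A v
IPCAxiom-valid {A} ax-S v   = valid-by-truth-table A v
IPCAxiom-valid {A} ax-∧E₁ v = valid-by-truth-table A v
IPCAxiom-valid {A} ax-∧E₂ v = valid-by-truth-table A v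
IPCAxiom-valid {A} ax-∧I v  = valid-by-truth-table A v
IPCAxiom-valid {A} ax-∨I₁ v = valid-by-truth-table A v
IPCAxiom-valid {A} ax-∨I₂ v = valid-by-truth-table A v
IPCAxiom-valid {A} ax-∨E v  = valid-by-truth-table A v
IPCAxiom-valid {A} ax-⊥E v  = valid-by-truth-table A v

K□-valid : Valid K□
K□-valid v = valid-by-truth-table K□ v

⇛-mp : ∀ {x y} → x ≡ 1₃ → x ⇛ y ≡ 1₃ → y ≡ 1₃
⇛-mp {y = 0₃} refl ()
⇛-mp {y = ½}  refl ()
⇛-mp {y = 1₃} refl _ = refl

CK□-sound : CK□⊢ φ → Valid φ
CK□-sound (ax {A} i (σ , refl) _) = valid-instance σ A (IPCAxiom-valid i)
CK□-sound (k (σ , refl) _)        = valid-instance σ K□ K□-valid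
CK□-sound (mp d e) v              = ⇛-mp (CK□-sound d v) (CK□-sound e v)
CK□-sound (nec d) v               = cong □₃ (CK□-sound d v)

¬¬□⊥⇒□⊥-not-CK□ : ¬ CK□⊢ ¬¬□⊥⇒□⊥
¬¬□⊥⇒□⊥-not-CK□ d with CK□-sound d (λ _ → 0₃)
... | ()

N◇,I◇□-nonconservative : N◇ ∈Ax Ax → I◇□ ∈Ax Ax → ¬ ConservativeOverCK□ Ax
N◇,I◇□-nonconservative N∈ I∈ conservative =
  ¬¬□⊥⇒□⊥-not-CK□ (proj₁ (conservative ¬¬□⊥⇒□⊥ _) (N◇,I◇□⊢¬¬□⊥⇒□⊥ N∈ I∈))

mainTheorem3 : (Ax : AxSet) →
    (ConservativeOverCK□ Ax → (¬ (N◇ ∈Ax Ax) ⊎ ¬ (I◇□ ∈Ax Ax))) ×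
    ((¬ (N◇ ∈Ax Ax) ⊎ ¬ (I◇□ ∈Ax Ax)) → ConservativeOverCK□ Ax)
mainTheorem3 Ax = conservative⇒¬both , ¬both⇒conservative
  where
  conservative⇒¬both : ConservativeOverCK□ Ax → ¬ (N◇ ∈Ax Ax) ⊎ ¬ (I◇□ ∈Ax Ax)
  conservative⇒¬both conservative with Ax N◇ in N∈ | Ax I◇□ in I∈
  ... | false | _     = inj₁ λ ()
  ... | true  | false = inj₂ λ ()
  ... | true  | true  = ⊥-elim (N◇,I◇□-nonconservative N∈ I∈ conservative)

  ¬both⇒conservative : ¬ (N◇ ∈Ax Ax) ⊎ ¬ (I◇□ ∈Ax Ax) → ConservativeOverCK□ Ax
  ¬both⇒conservative (inj₁ N∉) = conservative-by-erasure (tt , tt) (erasure-⊤-valid N∉)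
  ¬both⇒conservative (inj₂ I∉) = conservative-by-erasure tt (erasure-⊥-valid I∉)
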